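{- For every Hamiltonian cycle $H$ of $G$ with $e\in E(H)$ and $\chi_H(\ell)=\lambda(\ell)$ for all $\ell\in L$, there exists a perfect matching $M_H$ of $F_\lambda$ with $\mathrm{ham}(M_H)=H$.
   Context: Graphs are finite, undirected, simple. $G$ is a bipartite Pfaffian graph with $n$ vertices and a fixed Pfaffian orientation $\vec G$ (an orientation such that for every cycle $C$ of $G$ for which $G\setminus V(C)$ has a perfect matching, each of the two orientations of $C$ as a directed cycle shares an odd number of arcs with $\vec G$). Fix $e=\{s,t\}\in E(G)$ with $(s,t)\in E(\vec G)$ and let $\vec G_e$ be $\vec G$ with $(s,t)$ replaced by $(t,s)$. For a Hamiltonian cycle $H$ containing $e$, list its vertices $v_0=s,\dots,v_{n-1}=t$ along $H$ and set $\chi_H(v_0)=0$, $\chi_H(v_{i+1})\equiv\chi_H(v_i)+[(v_i,v_{i+1})\in E(\vec G_e)]\pmod 2$ ($[P]\in\{0,1\}$ is the indicator of $P$). Let $(L,R)$ be a bipartition of $V(G)$ with $s\in L$, $t\in R$, every edge having one end in each, and let $\lambda:L\to\{0,1\}$ with $\lambda(s)=0$. The graph $F_\lambda$ has vertex set $V(G)\times\{0,1\}$ (vertices written $[u,k]$), and for $\ell\in L$, $r\in R$, $p,\rho\in\{0,1\}$ with $\{\ell,r\}\in E(G)$, $\{[\ell,p],[r,\rho]\}\in E(F_\lambda)$ iff $\rho\equiv\lambda(\ell)+[(\ell,r)\in E(\vec G_e)]\pmod 2$ and ($\ell\ne s$ or $p\ne0$ or $r=t$). For a perfect matching $M$ of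 $F_\lambda$, $\mathrm{ham}(M)$ is defined by the traversal: $\ell_0=s$, $p_0=1$; for $i\ge0$, $[r_i,\rho_i]$ is the $M$-partner of $[\ell_i,p_i]$, $[\ell_{i+1},p_i']$ is the $M$-partner of $[r_i,1-\rho_i]$, $p_{i+1}=1-p_i'$; for the least $k\ge1$ with $\ell_k=s$, $\mathrm{ham}(M)$ is the closed walk $\ell_0,r_0,\ell_1,\dots,\ell_{k-1},r_{k-1},\ell_0$ (which is a Hamiltonian cycle of $G$ through $e$). -}

module Defs where

open import Data.Nat using (ℕ; zero; suc; _+_; _*_; _∸_; _<_; _≤_; _<?_; _%_)
open import Data.Fin using (Fin; toℕ; fromℕ<; _≟_) renaming (zero to fzero)
open import Data.Bool using (Bool; true; false; _xor_; _∧_; not; if_then_else_)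
open import Data.Product using (Σ; _×_; _,_; proj₁; proj₂)
open import Data.Sum using (_⊎_)
open import Relation.Nullary using (¬_; yes; no)
open import Relation.Nullary.Decidable using (⌊_⌋)
open import Relation.Binary.PropositionalEquality using (_≡_; _≢_)
open import Function.Definitions using (Injective)

-- Bits {0,1} are Bool (false = 0, true = 1); addition mod 2 is _xor_;
-- the indicator [P] of a Boolean-valued predicate is the Bool itself.

record Graph (n : ℕ) : Set where
  field
    adj   : Fin n → Fin n → Bool
    sym   : ∀ u v → adj u v ≡ adj v u
    irrefl : ∀ u → adj u u ≡ false

open Graph public

record Orientation {n : ℕ} (G : Graph n) : Set where
  field
    arc      : Fin n → Fin n → Bool
    arc⊆adj  : ∀ u v → arc u v ≡ true → adj G u v ≡ true
    oneway   : ∀ u v → adj G u v ≡ true → arc u v xor arc v u ≡ true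

open Orientation public

next : {k : ℕ} → Fin k → Fin k
next {suc k} i with suc (toℕ i) <? suc k
... | yes p = fromℕ< p
... | no _  = fzero

record Cycle {n : ℕ} (G : Graph n) : Set where
  field
    len   : ℕ
    len≥3 : 3 ≤ len
    vtx   : Fin len → Fin n
    inj   : Injective _≡_ _≡_ vtx
    edges : ∀ i → adj G (vtx i) (vtx (next i)) ≡ true

open Cycle public

countTrue : (k : ℕ) → (Fin k → Bool) → ℕ
countTrue zero    f = 0
countTrue (suc k) f = (if f fzero then 1 else 0) + countTrue k (λ i → f (Data.Fin.suc i))

Odd : ℕ → Set
Odd m = m % 2 ≡ 1

NotOn : {n : ℕ} {G : Graph n} → Cycle G → Fin n → Set
NotOn C v = ∀ i → vtx C i ≢ v

PerfectMatchingOff : {n : ℕ} (G : Graph n) (C : Cycle G) → (Fin n → Fin n) → Set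
PerfectMatchingOff G C m =
  ∀ v → NotOn C v → NotOn C (m v) × adj G v (m v) ≡ true × m (m v) ≡ v

Pfaffian : {n : ℕ} (G : Graph n) → Orientation G → Set
Pfaffian G D =
  ∀ (C : Cycle G) → Σ (Fin _ → Fin _) (PerfectMatchingOff G C) →
    Odd (countTrue (len C) (λ i → arc D (vtx C i) (vtx C (next i))))
    × Odd (countTrue (len C) (λ i → arc D (vtx C (next i)) (vtx C i)))

arcE : {n : ℕ} {G : Graph n} → Orientation G → Fin n → Fin n → Fin n → Fin n → Bool
arcE D s t u v =
  if ⌊ u ≟ s ⌋ ∧ ⌊ v ≟ t ⌋ then false
  else if ⌊ u ≟ t ⌋ ∧ ⌊ v ≟ s ⌋ then true
  else arc D u v

-- ℕ-indexed access to a listing (default value s outside the range)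
at : {n : ℕ} → Fin n → (Fin n → Fin n) → ℕ → Fin n
at {n} s v j with j <? n
... | yes p = v (fromℕ< p)
... | no _  = s

record HamCycleThrough {n : ℕ} (G : Graph n) (s t : Fin n) : Set where
  field
    seq     : Fin n → Fin n
    inj     : Injective _≡_ _≡_ seq
    n≥3     : 3 ≤ n
    first   : at s seq 0 ≡ s
    last    : at s seq (n ∸ 1) ≡ t
    edges   : ∀ j → suc j < n → adj G (at s seq j) (at s seq (suc j)) ≡ true
    -- the closing edge {v_{n-1}, v₀} = {t, s} = e is an edge of G by hypothesis

open HamCycleThrough public

-- χ_H along the listing, indexed by position
chi : {n : ℕ} {G : Graph n} (D : Orientation G) (s t : Fin n) →
      HamCycleThrough G s t → ℕ → Bool
chi D s t H zero    = false
chi D s t H (suc j) =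
  chi D s t H j xor arcE D s t (at s (seq H) j) (at s (seq H) (suc j))

-- The graph F_λ on V(G) × {0,1}.  side u ≡ true means u ∈ L.

FadjLR : {n : ℕ} (G : Graph n) (D : Orientation G) (s t : Fin n)
         (lam : Fin n → Bool) → Fin n × Bool → Fin n × Bool → Set
FadjLR G D s t lam (l , p) (r , ρ) =
  adj G l r ≡ true × ρ ≡ (lam l xor arcE D s t l r) × (l ≢ s ⊎ (p ≡ true ⊎ r ≡ t))

Fadj : {n : ℕ} (G : Graph n) (D : Orientation G) (s t : Fin n)
       (side : Fin n → Bool) (lam : Fin n → Bool) → Fin n × Bool → Fin n × Bool → Set
Fadj G D s t side lam x y =
  (side (proj₁ x) ≡ true × side (proj₁ y) ≡ false × FadjLR G D s t lam x y)
  ⊎ (side (proj₁ y) ≡ true × side (proj₁ x) ≡ false × FadjLR G D s t lam y x)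

PerfectMatchingF : {n : ℕ} (G : Graph n) (D : Orientation G) (s t : Fin n)
                   (side : Fin n → Bool) (lam : Fin n → Bool) →
                   (Fin n × Bool → Fin n × Bool) → Set
PerfectMatchingF G D s t side lam M =
  ∀ x → Fadj G D s t side lam x (M x) × M (M x) ≡ x

step : {n : ℕ} → (Fin n × Bool → Fin n × Bool) → Fin n × Bool → Fin n × Bool
step M x with M x
... | (r , ρ) with M (r , not ρ)
...   | (l' , p') = (l' , not p')

state : {n : ℕ} → (Fin n × Bool → Fin n × Bool) → Fin n → ℕ → Fin n × Bool
state M s zero    = (s , true)
state M s (suc i) = step M (state M s i)

walkFrom : {n : ℕ} → (Fin n × Bool → Fin n × Bool) → Fin n × Bool → ℕ → Fin n
walkFrom M x zero          = proj₁ x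
walkFrom M x (suc zero)    = proj₁ (M x)
walkFrom M x (suc (suc j)) = walkFrom M (step M x) j

-- ham(M) = H : with k the least k ≥ 1 such that ℓ_k = s, the closed walk
-- ℓ₀, r₀, …, ℓ_{k-1}, r_{k-1}, ℓ₀ coincides with the cycle H
-- (as a cyclic sequence starting at s, in either direction).
HamIs : {n : ℕ} {G : Graph n} {s t : Fin n} →
        (Fin n × Bool → Fin n × Bool) → HamCycleThrough G s t → Set
HamIs {n} {G} {s} {t} M H =
  Σ ℕ λ k →
    1 ≤ k
    × proj₁ (state M s k) ≡ s
    × (∀ j → 1 ≤ j → j < k → proj₁ (state M s j) ≢ s)
    × 2 * k ≡ n
    × ((∀ (i : Fin n) → walkFrom M (s , true) (toℕ i) ≡ seq H i)
       ⊎ (∀ (i : Fin n) → 1 ≤ toℕ i → walkFrom M (s , true) (n ∸ toℕ i) ≡ seq H i))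

-- List H as s = v₀, v₁, …, v_{n-1} = t.  Since G is bipartite and H closes up through the
-- edge ts, L consists exactly of the even positions, and n is even.  For even j the hypothesis
-- χ_H(v_j) = λ(v_j) says precisely that [v_j,1]–[v_{j+1},χ_H(v_{j+1})] is an edge of F_λ, and
-- since G_e orients each edge one way, so is [v_{j+2},0]–[v_{j+1},1−χ_H(v_{j+1})].  These n
-- edges cover V(F_λ); the only delicate one is the wrap-around edge [s,0]–[t,1−χ_H(t)], which
-- needs χ_H(t) = 1.  That is where the Pfaffian orientation enters: H spans G, so G ∖ V(H) has
-- the empty perfect matching and the traversal s → ⋯ → t → s uses an odd number of arcs of G⃗.
-- Its closing step t → s is not one of them and the other steps agree in G⃗ and G⃗_e, whence
-- χ_H(t) = 1.  Starting from [s,1], each round of the traversal defining ham(M_H) then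
-- advances two positions along H.

module Submission where

open import Defs hiding (sym)
open import Data.Nat using (ℕ; zero; suc; _+_; _*_; _∸_; _<_; _≤_; _<?_; z≤n; s≤s; z<s; pred; >-nonZero)
open import Data.Nat.Properties
  using ( ≤-refl; ≤-trans; <-trans; ≤-<-trans; <⇒≤; <⇒≱; <⇒≢; <-irrefl; n<1+n; m≤n⇒m<n∨m≡n
        ; 1+n≢0; m≤m+n; +-comm; +-identityʳ; +-suc; *-suc; suc-pred; *-monoʳ-<)
open import Data.Fin using (Fin; toℕ; fromℕ<; punchOut) renaming (zero to fzero; suc to fsuc; _≟_ to _≟ᶠ_)
open import Data.Fin.Properties
  using (toℕ-fromℕ<; fromℕ<-toℕ; fromℕ<-cong; toℕ<n; any?; injective⇒≤; punchOut-injective)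
open import Data.Bool using (Bool; true; false; not; _xor_; if_then_else_)
open import Data.Bool.Properties
  using (not-involutive; not-injective; not-¬; ¬-not; xor-same; xor-assoc; xor-comm; xor-identityʳ; xor-inverseˡ)
  renaming (_≟_ to _≟ᵇ_)
open import Data.Product using (Σ; ∃; _×_; _,_; proj₁; proj₂)
open import Data.Sum using (_⊎_; inj₁; inj₂)
open import Data.Empty using (⊥-elim)
open import Function.Definitions using (Injective)
open import Relation.Nullary using (¬_; yes; no; _×-dec_)
open import Relation.Binary.PropositionalEquality
  using (_≡_; _≢_; refl; sym; trans; cong; cong₂; subst; subst₂; module ≡-Reasoning)

parity : ℕ → Bool
parity zero    = false
parity (suc m) = not (parity m)

parity-suc-suc : ∀ m → parity (suc (suc m)) ≡ parity m
parity-suc-suc m = not-involutive (parity m)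

Odd⇒parity : ∀ m → Odd m → parity m ≡ true
Odd⇒parity (suc zero)    _ = refl
Odd⇒parity (suc (suc m)) o = trans (parity-suc-suc m) (Odd⇒parity m o)

parity-double : ∀ h → parity (2 * h) ≡ false
parity-double zero    = refl
parity-double (suc h) = trans (cong parity (*-suc 2 h)) (trans (parity-suc-suc (2 * h)) (parity-double h))

parity≡false⇒double : ∀ m → parity m ≡ false → ∃ λ h → m ≡ 2 * h
parity≡false⇒double zero          _ = 0 , refl
parity≡false⇒double (suc (suc m)) e with parity≡false⇒double m (trans (sym (parity-suc-suc m)) e)
... | h , refl = suc h , sym (*-suc 2 h)

xorUpTo : ℕ → (ℕ → Bool) → Bool
xorUpTo zero    g = false
xorUpTo (suc k) g = xorUpTo k g xor g k

xorUpTo-cong : ∀ k {g h : ℕ → Bool} → (∀ j → j < k → g j ≡ h j) → xorUpTo k g ≡ xorUpTo k h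
xorUpTo-cong zero    g≡h = refl
xorUpTo-cong (suc k) g≡h =
  cong₂ _xor_ (xorUpTo-cong k (λ j j<k → g≡h j (<-trans j<k (n<1+n k)))) (g≡h k ≤-refl)

xorUpTo-unfoldˡ : ∀ k g → xorUpTo (suc k) g ≡ g 0 xor xorUpTo k (λ j → g (suc j))
xorUpTo-unfoldˡ zero    g = sym (xor-identityʳ (g 0))
xorUpTo-unfoldˡ (suc k) g =
  trans (cong (_xor g (suc k)) (xorUpTo-unfoldˡ k g)) (xor-assoc (g 0) _ (g (suc k)))

parity-countTrue : ∀ k (f : Fin k → Bool) (g : ℕ → Bool) → (∀ i → f i ≡ g (toℕ i)) →
                   parity (countTrue k f) ≡ xorUpTo k g
parity-countTrue zero    f g f≡g = refl
parity-countTrue (suc k) f g f≡g = begin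
  parity ((if f fzero then 1 else 0) + countTrue k (λ i → f (fsuc i)))
    ≡⟨ parity-if (f fzero) _ ⟩
  f fzero xor parity (countTrue k (λ i → f (fsuc i)))
    ≡⟨ cong₂ _xor_ (f≡g fzero) (parity-countTrue k _ (λ j → g (suc j)) (λ i → f≡g (fsuc i))) ⟩
  g 0 xor xorUpTo k (λ j → g (suc j))
    ≡⟨ sym (xorUpTo-unfoldˡ k g) ⟩
  xorUpTo (suc k) g ∎
  where
  open ≡-Reasoning
  parity-if : ∀ b m → parity ((if b then 1 else 0) + m) ≡ b xor parity m
  parity-if true  m = refl
  parity-if false m = refl

injective⇒surjective : ∀ {m} {f : Fin m → Fin m} → Injective _≡_ _≡_ f → ∀ u → ∃ λ i → f i ≡ u
injective⇒surjective {suc m} {f} f-inj u with any? (λ i → f i ≟ᶠ u)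
... | yes hit  = hit
... | no  miss = ⊥-elim (<-irrefl refl (injective⇒≤ punch-inj))
  where
  u≢f : ∀ i → u ≢ f i
  u≢f i u≡fi = miss (i , sym u≡fi)
  punch-inj : Injective _≡_ _≡_ (λ i → punchOut (u≢f i))
  punch-inj e = f-inj (punchOut-injective (u≢f _) (u≢f _) e)

module _ {m : ℕ} (d : Fin m) (xs : Fin m → Fin m) where

  at-< : ∀ {j} (j<m : j < m) → at d xs j ≡ xs (fromℕ< j<m)
  at-< {j} j<m with j <? m
  ... | yes j<m′ = cong xs (fromℕ<-cong j j refl j<m′ j<m)
  ... | no  j≮m  = ⊥-elim (j≮m j<m)

  at-≥ : ∀ {j} → m ≤ j → at d xs j ≡ d
  at-≥ {j} m≤j with j <? m
  ... | yes j<m = ⊥-elim (<⇒≱ j<m m≤j)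
  ... | no  _   = refl

  at-toℕ : ∀ i → at d xs (toℕ i) ≡ xs i
  at-toℕ i = trans (at-< (toℕ<n i)) (cong xs (fromℕ<-toℕ i (toℕ<n i)))

  at-injective : Injective _≡_ _≡_ xs → ∀ {j k} → j < m → k < m → at d xs j ≡ at d xs k → j ≡ k
  at-injective xs-inj {j} {k} j<m k<m e = begin
    j                     ≡⟨ toℕ-fromℕ< j<m ⟨
    toℕ (fromℕ< j<m)      ≡⟨ cong toℕ (xs-inj (trans (sym (at-< j<m)) (trans e (at-< k<m)))) ⟩
    toℕ (fromℕ< k<m)      ≡⟨ toℕ-fromℕ< k<m ⟩
    k                     ∎
    where open ≡-Reasoning

at-next : ∀ {m} (d : Fin m) (xs : Fin m → Fin m) → at d xs 0 ≡ d →
          ∀ i → xs (next i) ≡ at d xs (suc (toℕ i))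
at-next {suc m} d xs xs₀≡d i with suc (toℕ i) <? suc m
... | yes _ = refl
... | no  _ = trans (sym (at-< d xs z<s)) xs₀≡d

module _ {n : ℕ} (G : Graph n) where

  adj-sym : ∀ {u w} → adj G u w ≡ true → adj G w u ≡ true
  adj-sym {u} {w} e = trans (Graph.sym G w u) e

  adj⇒≢ : ∀ {u w} → adj G u w ≡ true → u ≢ w
  adj⇒≢ {u} e refl with trans (sym e) (irrefl G u)
  ... | ()

module _ {n : ℕ} {G : Graph n} (D : Orientation G) {s t : Fin n} where

  arcE-st : arcE D s t s t ≡ false
  arcE-st with s ≟ᶠ s | t ≟ᶠ t
  ... | yes _ | yes _   = refl
  ... | no s≢s | _      = ⊥-elim (s≢s refl)
  ... | yes _ | no t≢t  = ⊥-elim (t≢t refl)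

  arcE-ts : s ≢ t → arcE D s t t s ≡ true
  arcE-ts s≢t with t ≟ᶠ s | t ≟ᶠ t | s ≟ᶠ s
  ... | yes t≡s | _      | _      = ⊥-elim (s≢t (sym t≡s))
  ... | no _    | yes _  | yes _  = refl
  ... | no _    | no t≢t | _      = ⊥-elim (t≢t refl)
  ... | no _    | yes _  | no s≢s = ⊥-elim (s≢s refl)

  arcE-off : ∀ {u w} → ¬ (u ≡ s × w ≡ t) → ¬ (u ≡ t × w ≡ s) → arcE D s t u w ≡ arc D u w
  arcE-off {u} {w} ¬st ¬ts with u ≟ᶠ s | w ≟ᶠ t | u ≟ᶠ t | w ≟ᶠ s
  ... | yes p | yes q | _     | _     = ⊥-elim (¬st (p , q))
  ... | _     | _     | yes p | yes q = ⊥-elim (¬ts (p , q))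
  ... | yes _ | no _  | yes _ | no _  = refl
  ... | yes _ | no _  | no _  | _     = refl
  ... | no _  | _     | yes _ | no _  = refl
  ... | no _  | _     | no _  | _     = refl

  arcE-oneway : s ≢ t → ∀ {u w} → adj G u w ≡ true → arcE D s t u w xor arcE D s t w u ≡ true
  arcE-oneway s≢t {u} {w} e with (u ≟ᶠ s) ×-dec (w ≟ᶠ t) | (u ≟ᶠ t) ×-dec (w ≟ᶠ s)
  ... | yes (refl , refl) | _                 = cong₂ _xor_ arcE-st (arcE-ts s≢t)
  ... | no _              | yes (refl , refl) = cong₂ _xor_ (arcE-ts s≢t) arcE-st
  ... | no ¬st            | no ¬ts            =
    trans (cong₂ _xor_ (arcE-off ¬st ¬ts) (arcE-off (λ (p , q) → ¬ts (q , p)) (λ (p , q) → ¬st (q , p))))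
          (oneway D u w e)

arc⇒reverse≡false : ∀ {n} {G : Graph n} (D : Orientation G) {u w} → arc D u w ≡ true → arc D w u ≡ false
arc⇒reverse≡false D {u} {w} uw =
  not-injective (trans (cong (_xor arc D w u) (sym uw)) (oneway D u w (arc⊆adj D u w uw)))

step-unfold : ∀ {n} (M : Fin n × Bool → Fin n × Bool) {x r ρ l p} →
         M x ≡ (r , ρ) → M (r , not ρ) ≡ (l , p) → step M x ≡ (l , not p)
step-unfold M {x} e₁ e₂ rewrite e₁ | e₂ = refl

module HamiltonianListing {n : ℕ} {G : Graph n} {s t : Fin n} (H : HamCycleThrough G s t) where

  v : ℕ → Fin n
  v = at s (seq H)

  0<n : 0 < n
  0<n = ≤-trans (s≤s z≤n) (n≥3 H)

  suc-last : suc (n ∸ 1) ≡ n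
  suc-last = suc-pred n {{>-nonZero 0<n}}

  last<n : n ∸ 1 < n
  last<n = subst (n ∸ 1 <_) suc-last ≤-refl

  inner-or-last : ∀ {k} → k < n → suc k < n ⊎ k ≡ n ∸ 1
  inner-or-last k<n with m≤n⇒m<n∨m≡n k<n
  ... | inj₁ sk<n = inj₁ sk<n
  ... | inj₂ sk≡n = inj₂ (cong pred sk≡n)

  v-0 : v 0 ≡ s
  v-0 = first H

  v-last : v (n ∸ 1) ≡ t
  v-last = last H

  -- `at` returns s past the end of the listing, so v n ≡ v 0: positions wrap around H.
  v-n : v n ≡ s
  v-n = at-≥ s (seq H) ≤-refl

  v-suc-last : v (suc (n ∸ 1)) ≡ s
  v-suc-last = trans (cong v suc-last) v-n

  v-injective : ∀ {j k} → j < n → k < n → v j ≡ v k → j ≡ k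
  v-injective = at-injective s (seq H) (inj H)

  v-suc≢s : ∀ {j} → suc j < n → v (suc j) ≢ s
  v-suc≢s sj<n e with v-injective sj<n 0<n (trans e (sym v-0))
  ... | ()

  position : ∀ u → ∃ λ j → j < n × v j ≡ u
  position u with injective⇒surjective (inj H) u
  ... | i , seq-i≡u = toℕ i , toℕ<n i , trans (at-toℕ s (seq H) i) seq-i≡u

  pos : Fin n → ℕ
  pos u = proj₁ (position u)

  pos<n : ∀ u → pos u < n
  pos<n u = proj₁ (proj₂ (position u))

  v-pos : ∀ u → v (pos u) ≡ u
  v-pos u = proj₂ (proj₂ (position u))

  pos-v : ∀ {j} → j < n → pos (v j) ≡ j
  pos-v {j} j<n = v-injective (pos<n (v j)) j<n (v-pos (v j))

  prev : ℕ → ℕ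
  prev zero    = n ∸ 1
  prev (suc j) = j

  prev-< : ∀ {j} → j < n → prev j < n
  prev-< {zero}  _    = last<n
  prev-< {suc j} sj<n = <-trans (n<1+n j) sj<n

  v-suc-prev : ∀ j → v (suc (prev j)) ≡ v j
  v-suc-prev zero    = trans v-suc-last (sym v-0)
  v-suc-prev (suc j) = refl

  module ClosingEdge (e-adj : adj G s t ≡ true) where

    v-adjacent : ∀ {j} → j < n → adj G (v j) (v (suc j)) ≡ true
    v-adjacent {j} j<n with inner-or-last j<n
    ... | inj₁ sj<n = edges H j sj<n
    ... | inj₂ refl = subst₂ (λ a b → adj G a b ≡ true) (sym v-last) (sym v-suc-last) (adj-sym G e-adj)

    hamCycle : Cycle G
    hamCycle = record
      { len   = n
      ; len≥3 = n≥3 H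
      ; vtx   = seq H
      ; inj   = inj H
      ; edges = λ i → subst₂ (λ a b → adj G a b ≡ true)
                        (at-toℕ s (seq H) i) (sym (at-next s (seq H) v-0 i)) (v-adjacent (toℕ<n i))
      }

    -- G ∖ V(H) is empty, so any partner function is a perfect matching of it.
    hamCycle-complementMatching : PerfectMatchingOff G hamCycle (λ u → u)
    hamCycle-complementMatching u u∉H with injective⇒surjective (inj H) u
    ... | i , seq-i≡u = ⊥-elim (u∉H i seq-i≡u)

    module Bipartite (side : Fin n → Bool) (s∈L : side s ≡ true)
             (bipartite : ∀ u w → adj G u w ≡ true → side u ≢ side w) where

      side-v : ∀ {j} → j ≤ n → side (v j) ≡ not (parity j)
      side-v {zero}  _     = trans (cong side v-0) s∈L
      side-v {suc j} sj≤n =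
        trans (¬-not (λ e → bipartite _ _ (v-adjacent sj≤n) (sym e))) (cong not (side-v (<⇒≤ sj≤n)))

      parity-n : parity n ≡ false
      parity-n = not-injective (trans (sym (side-v ≤-refl)) (trans (cong side v-n) s∈L))

      side-even : ∀ {j} → j ≤ n → parity j ≡ false → side (v j) ≡ true
      side-even j≤n e = trans (side-v j≤n) (cong not e)

      side-odd : ∀ {j} → j ≤ n → parity j ≡ true → side (v j) ≡ false
      side-odd j≤n o = trans (side-v j≤n) (cong not o)

      parity-last : parity (n ∸ 1) ≡ true
      parity-last = not-injective (trans (cong parity suc-last) parity-n)

      even-suc-< : ∀ {j} → j < n → parity j ≡ false → suc j < n
      even-suc-< j<n e with inner-or-last j<n
      ... | inj₁ sj<n = sj<n
      ... | inj₂ refl = ⊥-elim (not-¬ e parity-last)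

      parity-prev : ∀ j → parity j ≡ false → parity (prev j) ≡ true
      parity-prev zero    _ = parity-last
      parity-prev (suc j) e = not-injective e

    module PfaffianParity (D : Orientation G) (pfaffian : Pfaffian G D) (e-arc : arc D s t ≡ true) where

      private
        arcD arcDₑ : ℕ → Bool
        arcD  j = arc D (v j) (v (suc j))
        arcDₑ j = arcE D s t (v j) (v (suc j))

        chi≡xorUpTo : ∀ j → chi D s t H j ≡ xorUpTo j arcDₑ
        chi≡xorUpTo zero    = refl
        chi≡xorUpTo (suc j) = cong (_xor arcDₑ j) (chi≡xorUpTo j)

        arcDₑ≡arcD : ∀ j → j < n ∸ 1 → arcDₑ j ≡ arcD j
        arcDₑ≡arcD j j<last = arcE-off D ¬st ¬ts
          where
          j<n : j < n
          j<n = <-trans j<last last<n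
          sj<n : suc j < n
          sj<n = subst (suc (suc j) ≤_) suc-last (s≤s j<last)
          ¬st : ¬ (v j ≡ s × v (suc j) ≡ t)
          ¬st (vj≡s , vsj≡t) with v-injective j<n 0<n (trans vj≡s (sym v-0))
          ... | refl = <⇒≢ (n≥3 H) (trans (cong suc 1≡last) suc-last)
            where 1≡last = v-injective sj<n last<n (trans vsj≡t (sym v-last))
          ¬ts : ¬ (v j ≡ t × v (suc j) ≡ s)
          ¬ts (vj≡t , _) = <⇒≢ j<last (v-injective j<n last<n (trans vj≡t (sym v-last)))

        arcD-closing : arcD (n ∸ 1) ≡ false
        arcD-closing = trans (cong₂ (arc D) v-last v-suc-last) (arc⇒reverse≡false D e-arc)

        xorUpTo-arcD : xorUpTo n arcD ≡ true
        xorUpTo-arcD =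
          trans (sym (parity-countTrue n _ arcD steps≡arcD))
                (Odd⇒parity (countTrue n _) (proj₁ (pfaffian hamCycle ((λ u → u) , hamCycle-complementMatching))))
          where
          steps≡arcD : ∀ i → arc D (seq H i) (seq H (next i)) ≡ arcD (toℕ i)
          steps≡arcD i = cong₂ (arc D) (sym (at-toℕ s (seq H) i)) (at-next s (seq H) v-0 i)

      chi-last : chi D s t H (n ∸ 1) ≡ true
      chi-last = begin
        chi D s t H (n ∸ 1)                 ≡⟨ chi≡xorUpTo (n ∸ 1) ⟩
        xorUpTo (n ∸ 1) arcDₑ               ≡⟨ xorUpTo-cong (n ∸ 1) arcDₑ≡arcD ⟩
        xorUpTo (n ∸ 1) arcD                ≡⟨ xor-identityʳ _ ⟨
        xorUpTo (n ∸ 1) arcD xor false      ≡⟨ cong (xorUpTo (n ∸ 1) arcD xor_) arcD-closing ⟨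
        xorUpTo (suc (n ∸ 1)) arcD          ≡⟨ cong (λ m → xorUpTo m arcD) suc-last ⟩
        xorUpTo n arcD                      ≡⟨ xorUpTo-arcD ⟩
        true                                ∎
        where open ≡-Reasoning

Fadj-sym : ∀ {n} {G : Graph n} {D : Orientation G} {s t side lam x y} →
           Fadj G D s t side lam x y → Fadj G D s t side lam y x
Fadj-sym (inj₁ x~y) = inj₂ x~y
Fadj-sym (inj₂ y~x) = inj₁ y~x

module Construction
  {n : ℕ} {G : Graph n} (D : Orientation G) (pfaffian : Pfaffian G D)
  {s t : Fin n} (e-adj : adj G s t ≡ true) (e-arc : arc D s t ≡ true)
  (side : Fin n → Bool) (s∈L : side s ≡ true)
  (bipartite : ∀ u w → adj G u w ≡ true → side u ≢ side w)
  (lam : Fin n → Bool) (lam-s : lam s ≡ false)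
  (H : HamCycleThrough G s t)
  (chi≡lam : ∀ i → side (seq H i) ≡ true → chi D s t H (toℕ i) ≡ lam (seq H i)) where

  open HamiltonianListing H
  open ClosingEdge e-adj
  open Bipartite side s∈L bipartite
  open PfaffianParity D pfaffian e-arc

  χ : ℕ → Bool
  χ = chi D s t H

  χ-even : ∀ {j} → j < n → parity j ≡ false → χ j ≡ lam (v j)
  χ-even {j} j<n e = subst₂ (λ k u → χ k ≡ lam u) (toℕ-fromℕ< j<n) (sym vj≡seq)
                       (chi≡lam (fromℕ< j<n) (trans (cong side (sym vj≡seq)) (side-even (<⇒≤ j<n) e)))
    where
    vj≡seq : v j ≡ seq H (fromℕ< j<n)
    vj≡seq = at-< s (seq H) j<n

  -- For every even j, [v_j,1] is paired with [v_{j+1},χ_{j+1}] and [v_{j+2},0] with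
  -- [v_{j+1},¬χ_{j+1}], positions read mod n; the first argument is the parity of the position.
  oddPartner : ℕ → Bool → Fin n × Bool
  oddPartner k true  = v (suc k) , false
  oddPartner k false = v (prev k) , true

  partner : Bool → ℕ → Bool → Fin n × Bool
  partner false j true  = v (suc j) , χ (suc j)
  partner false j false = v (prev j) , not (χ (prev j))
  partner true  k b     = oddPartner k (b xor χ k)

  M : Fin n × Bool → Fin n × Bool
  M (u , b) = partner (parity (pos u)) (pos u) b

  M-v : ∀ {j} → j < n → ∀ b → M (v j , b) ≡ partner (parity j) j b
  M-v j<n b = cong (λ k → partner (parity k) k b) (pos-v j<n)

  M-even-true : ∀ {j} → j < n → parity j ≡ false → M (v j , true) ≡ (v (suc j) , χ (suc j))
  M-even-true {j} j<n e = trans (M-v j<n true) (cong (λ c → partner c j true) e)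

  M-even-false : ∀ {j} → j < n → parity j ≡ false → M (v j , false) ≡ (v (prev j) , not (χ (prev j)))
  M-even-false {j} j<n e = trans (M-v j<n false) (cong (λ c → partner c j false) e)

  M-odd-χ : ∀ {k} → k < n → parity k ≡ true → M (v k , χ k) ≡ (v (prev k) , true)
  M-odd-χ {k} k<n o = begin
    M (v k , χ k)               ≡⟨ M-v k<n (χ k) ⟩
    partner (parity k) k (χ k)  ≡⟨ cong (λ c → partner c k (χ k)) o ⟩
    oddPartner k (χ k xor χ k)  ≡⟨ cong (oddPartner k) (xor-same (χ k)) ⟩
    (v (prev k) , true)         ∎
    where open ≡-Reasoning

  M-odd-¬χ : ∀ {k} → k < n → parity k ≡ true → M (v k , not (χ k)) ≡ (v (suc k) , false)
  M-odd-¬χ {k} k<n o = begin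
    M (v k , not (χ k))                ≡⟨ M-v k<n (not (χ k)) ⟩
    partner (parity k) k (not (χ k))   ≡⟨ cong (λ c → partner c k (not (χ k))) o ⟩
    oddPartner k (not (χ k) xor χ k)   ≡⟨ cong (oddPartner k) (xor-inverseˡ (χ k)) ⟩
    (v (suc k) , false)                ∎
    where open ≡-Reasoning

  M-after-odd : ∀ {k} → k < n → parity k ≡ true → M (v (suc k) , false) ≡ (v k , not (χ k))
  M-after-odd k<n o with inner-or-last k<n
  ... | inj₁ sk<n = M-even-false sk<n (cong not o)
  ... | inj₂ refl = trans (cong (λ u → M (u , false)) (v-suc-prev 0)) (M-even-false 0<n refl)

  forward-edge : ∀ {j} → j < n → parity j ≡ false →
                 FadjLR G D s t lam (v j , true) (v (suc j) , χ (suc j))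
  forward-edge {j} j<n e =
    v-adjacent j<n , cong (_xor arcE D s t (v j) (v (suc j))) (χ-even j<n e) , inj₂ (inj₁ refl)

  backward-label : ∀ {k} → k < n → parity k ≡ true →
                   not (χ k) ≡ lam (v (suc k)) xor arcE D s t (v (suc k)) (v k)
  backward-label {k} k<n o with inner-or-last k<n
  ... | inj₁ sk<n = begin
    not (χ k)                                ≡⟨ xor-comm (χ k) true ⟨
    χ k xor true                             ≡⟨ cong (χ k xor_) (arcE-oneway D s≢t (v-adjacent k<n)) ⟨
    χ k xor (aₖ xor aₖ′)                      ≡⟨ xor-assoc (χ k) aₖ aₖ′ ⟨
    χ (suc k) xor aₖ′                         ≡⟨ cong (_xor aₖ′) (χ-even sk<n (cong not o)) ⟩
    lam (v (suc k)) xor aₖ′                   ∎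
    where
    open ≡-Reasoning
    s≢t = adj⇒≢ G e-adj
    aₖ  = arcE D s t (v k) (v (suc k))
    aₖ′ = arcE D s t (v (suc k)) (v k)
  ... | inj₂ refl = begin
    not (χ (n ∸ 1))                          ≡⟨ cong not chi-last ⟩
    false                                    ≡⟨ cong₂ _xor_ lam-s (arcE-st D {s} {t}) ⟨
    lam s xor arcE D s t s t                 ≡⟨ cong₂ (λ a b → lam a xor arcE D s t a b) v-suc-last v-last ⟨
    lam (v n′) xor arcE D s t (v n′) (v (n ∸ 1)) ∎
    where
    open ≡-Reasoning
    n′ = suc (n ∸ 1)

  backward-edge : ∀ {k} → k < n → parity k ≡ true →
                  FadjLR G D s t lam (v (suc k) , false) (v k , not (χ k))
  backward-edge {k} k<n o = adj-sym G (v-adjacent k<n) , backward-label k<n o , distinguished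
    where
    distinguished : v (suc k) ≢ s ⊎ (false ≡ true ⊎ v k ≡ t)
    distinguished with inner-or-last k<n
    ... | inj₁ sk<n = inj₁ (v-suc≢s sk<n)
    ... | inj₂ refl = inj₂ (inj₂ v-last)

  Matched : Fin n × Bool → Set
  Matched x = Fadj G D s t side lam x (M x) × M (M x) ≡ x

  matched-via : ∀ {x y} → M x ≡ y → Fadj G D s t side lam x y → M y ≡ x → Matched x
  matched-via {x} Mx≡y x~y My≡x =
    subst (Fadj G D s t side lam x) (sym Mx≡y) x~y , trans (cong M Mx≡y) My≡x

  matched-partner : ∀ x {y} → Matched x → M x ≡ y → Matched y
  matched-partner x (x~Mx , MMx≡x) refl =
    subst (Fadj G D s t side lam (M x)) (sym MMx≡x) (Fadj-sym {D = D} {side = side} {lam = lam} x~Mx)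
    , cong M MMx≡x

  matched-odd-χ : ∀ {k} → k < n → parity k ≡ true → Matched (v k , χ k)
  matched-odd-χ {suc j} k<n o =
    matched-via (M-odd-χ k<n o)
                (inj₂ (side-even (<⇒≤ j<n) e , side-odd (<⇒≤ k<n) o , forward-edge j<n e))
                (M-even-true j<n e)
    where
    j<n = <-trans (n<1+n j) k<n
    e   = not-injective o

  matched-odd-¬χ : ∀ {k} → k < n → parity k ≡ true → Matched (v k , not (χ k))
  matched-odd-¬χ {k} k<n o =
    matched-via (M-odd-¬χ k<n o)
                (inj₂ (side-even k<n (cong not o) , side-odd (<⇒≤ k<n) o , backward-edge k<n o))
                (M-after-odd k<n o)

  matched-v : ∀ {j} → j < n → ∀ b → Matched (v j , b)
  matched-v {j} j<n b with parity j in e | b ≟ᵇ χ j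
  ... | true  | yes refl = matched-odd-χ j<n e
  ... | true  | no b≢χ  = subst (λ c → Matched (v j , c)) (sym (¬-not b≢χ)) (matched-odd-¬χ j<n e)
  ... | false | _ with b
  ...   | true  = matched-partner _ (matched-odd-χ sj<n (cong not e)) (M-odd-χ sj<n (cong not e))
    where sj<n = even-suc-< j<n e
  ...   | false = matched-partner _ (matched-odd-¬χ (prev-< j<n) (parity-prev j e))
                    (trans (M-odd-¬χ (prev-< j<n) (parity-prev j e)) (cong (_, false) (v-suc-prev j)))

  M-perfect : PerfectMatchingF G D s t side lam M
  M-perfect (u , b) = subst (λ w → Matched (w , b)) (v-pos u) (matched-v (pos<n u) b)

  step-even : ∀ {j} → j < n → parity j ≡ false → step M (v j , true) ≡ (v (suc (suc j)) , true)
  step-even j<n e = step-unfold M (M-even-true j<n e) (M-odd-¬χ (even-suc-< j<n e) (cong not e))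

  state-double : ∀ i → 2 * i ≤ n → state M s i ≡ (v (2 * i) , true)
  state-double zero    _       = cong (_, true) (sym v-0)
  state-double (suc i) 2i+2≤n = begin
    step M (state M s i)            ≡⟨ cong (step M) (state-double i (<⇒≤ 2i<n)) ⟩
    step M (v (2 * i) , true)       ≡⟨ step-even 2i<n (parity-double i) ⟩
    (v (suc (suc (2 * i))) , true)  ≡⟨ cong (λ m → v m , true) (*-suc 2 i) ⟨
    (v (2 * suc i) , true)          ∎
    where
    open ≡-Reasoning
    2i<n : 2 * i < n
    2i<n = <⇒≤ (subst (_≤ n) (*-suc 2 i) 2i+2≤n)

  walk-even : ∀ {a} j → parity a ≡ false → a + j < n → walkFrom M (v a , true) j ≡ v (a + j)
  walk-even {a} zero          e _        = cong v (sym (+-identityʳ a))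
  walk-even {a} (suc zero)    e a+1<n    =
    trans (cong proj₁ (M-even-true (≤-<-trans (m≤m+n a 1) a+1<n) e)) (cong v (+-comm 1 a))
  walk-even {a} (suc (suc j)) e a+j+2<n = begin
    walkFrom M (step M (v a , true)) j       ≡⟨ cong (λ x → walkFrom M x j) (step-even a<n e) ⟩
    walkFrom M (v (suc (suc a)) , true) j
      ≡⟨ walk-even j (trans (parity-suc-suc a) e) (subst (_< n) shift a+j+2<n) ⟩
    v (suc (suc a) + j)                      ≡⟨ cong v shift ⟨
    v (a + suc (suc j))                      ∎
    where
    open ≡-Reasoning
    a<n = ≤-<-trans (m≤m+n a (suc (suc j))) a+j+2<n
    shift : a + suc (suc j) ≡ suc (suc a) + j
    shift = trans (+-suc a (suc j)) (cong suc (+-suc a j))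

  M-ham : HamIs M H
  M-ham with parity≡false⇒double n parity-n
  ... | zero  , n≡0  = ⊥-elim (<⇒≢ 0<n (sym n≡0))
  ... | suc h , n≡2h = suc h , s≤s z≤n , returns , no-early-return , sym n≡2h , inj₁ walk
    where
    returns : proj₁ (state M s (suc h)) ≡ s
    returns = trans (cong proj₁ (state-double (suc h) (subst (_≤ n) n≡2h ≤-refl)))
                    (trans (cong v (sym n≡2h)) v-n)
    no-early-return : ∀ j → 1 ≤ j → j < suc h → proj₁ (state M s j) ≢ s
    no-early-return (suc j) _ j<h e = 1+n≢0 (v-injective 2j<n 0<n (trans (sym state≡v) (trans e (sym v-0))))
      where
      2j<n : 2 * suc j < n
      2j<n = subst (2 * suc j <_) (sym n≡2h) (*-monoʳ-< 2 j<h)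
      state≡v : proj₁ (state M s (suc j)) ≡ v (2 * suc j)
      state≡v = cong proj₁ (state-double (suc j) (<⇒≤ 2j<n))
    walk : ∀ i → walkFrom M (s , true) (toℕ i) ≡ seq H i
    walk i = trans (cong (λ x → walkFrom M (x , true) (toℕ i)) (sym v-0))
                   (trans (walk-even (toℕ i) refl (toℕ<n i)) (at-toℕ s (seq H) i))

lemma2p4 : (n : ℕ) (G : Graph n) (D : Orientation G) → Pfaffian G D →
    (s t : Fin n) → adj G s t ≡ true → arc D s t ≡ true →
    (side : Fin n → Bool) → side s ≡ true → side t ≡ false →
    (∀ u v → adj G u v ≡ true → side u ≢ side v) →
    (lam : Fin n → Bool) → lam s ≡ false →
    (H : HamCycleThrough G s t) →
    (∀ (i : Fin n) → side (seq H i) ≡ true →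
       chi D s t H (toℕ i) ≡ lam (seq H i)) →
    Σ (Fin n × Bool → Fin n × Bool) λ M →
      PerfectMatchingF G D s t side lam M × HamIs M H
lemma2p4 n G D pfaffian s t e-adj e-arc side s∈L _ bipartite lam lam-s H chi≡lam =
  M , M-perfect , M-ham
  where open Construction D pfaffian e-adj e-arc side s∈L bipartite lam lam-s H chi≡lam
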